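{- Let $n,m$ be positive integers with $m\ge 2$ and $n\ge\sqrt{32m+260}+18$. Then there exist families $\mathcal{B},\mathcal{R}\subset\mathcal{Q}_{n+m}$ with $\mathcal{B}\cap\mathcal{R}=\emptyset$ and $\mathcal{B}\cup\mathcal{R}=\mathcal{Q}_{n+m}$ such that $\mathcal{Q}_m$ is not a weak subposet of $\mathcal{B}$ and $\mathcal{Q}_n$ is not a weak subposet of $\mathcal{R}$ (where $\mathcal{B}$ and $\mathcal{R}$ are ordered by inclusion).
   Context: For a positive integer $N$, the Boolean lattice $\mathcal{Q}_N$ is the power set of $[N]=\{1,\dots,N\}$ ordered by inclusion. For posets $P$ and $Q$, $P$ is a weak subposet of $Q$ if there is an injection $f:P\to Q$ such that $f(x)\le f(y)$ whenever $x\le y$. -}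

module Defs where

open import Data.Nat using (ℕ; _+_; _*_; _∸_; _≤_)
open import Data.Bool using (Bool; true; false)
open import Data.Fin.Subset using (Subset; _⊆_)
open import Data.Product using (Σ; _×_)
open import Relation.Binary.PropositionalEquality using (_≡_)
open import Function.Definitions using (Injective)

-- The Boolean lattice Q_N: elements are subsets of [N] (as Subset N), ordered by ⊆.

WeakSubposetOf : (k N : ℕ) → (Subset N → Set) → Set
WeakSubposetOf k N F =
  Σ (Subset k → Subset N) λ f →
    ((x : Subset k) → F (f x)) ×
    (Injective _≡_ _≡_ f ×
    ((x y : Subset k) → x ⊆ y → f x ⊆ f y))

-- The hypothesis n ≥ √(32m+260) + 18, equivalently n ≥ 18 and (n-18)^2 ≥ 32m+260.
SizeCondition : ℕ → ℕ → Set
SizeCondition n m = (18 ≤ n) × (32 * m + 260 ≤ (n ∸ 18) * (n ∸ 18))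

-- Colour X ⊆ [n + m] blue when ∣X∣ = 2, when ∣X∣ = 3 and X is collinear, or when ∣X∣ ≥ n + 2,
-- for a line system on [n + m] whose lines have at most m + 1 points and in which, seen from any
-- point, the other points fall into fewer than n directions, two points in one direction being
-- collinear with it.
--
-- A blue copy f of Q_m climbs the blue sizes 2, 3, n + 2, n + 3, … one step per level, so f ∅ is a
-- pair {a₁, a₂} and the f ⁅i⁆ are m distinct collinear triples containing it: m + 2 points on a line.
-- A red copy f of Q_n skips size 2, so ∣f x∣ = ∣x∣ + 1 once ∣x∣ ≥ 2. Then f ⊤ consists of one point o
-- together with the points d l missing from f (∁ ⁅l⁆), and f (⁅i⁆ ∪ ⁅j⁆) = {o, d i, d j}; by
-- pigeonhole two of the directions from o to the d l coincide, so one of these triples is collinear,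
-- hence blue.
--
-- The line system lives on two copies x, y of ℤ_g and h ≤ g further points z: the lines are the
-- triangles {x_i, y_j, z_(i+j)}, and, when g ≤ m + 1, the three groups x, y and z. Suitable choices
-- of g for n ≥ 2m + 2, for m + 3 ≤ n ≤ 2m + 3 and for n ≤ m + 2, and exchanging the colours when m
-- is much larger than n, give the colouring for all n ≥ 6 and m ≥ 2.

module Submission where

open import Data.Bool using (Bool; true; false; not; T)
import Data.Bool as Bool
open import Data.Bool.Properties using (not-injective)
open import Data.Empty using (⊥-elim)
open import Data.Fin using (Fin; zero; suc; toℕ; fromℕ<; inject≤; punchOut)
import Data.Fin.Properties as Finₚ
open import Data.Fin.Subset
open import Data.Fin.Subset.Properties
import Data.List as List
open import Data.Nat
  using (ℕ; zero; suc; _+_; _*_; _∸_; _≤_; _<_; z≤n; s≤s; _≤?_; _<?_; _≤ᵇ_; NonZero; >-nonZero; ⌊_/2⌋; ⌈_/2⌉)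
open import Data.Nat.DivMod
open import Data.Nat.Properties
open import Data.Nat.Tactic.RingSolver using (solve)
open import Data.Product using (Σ; ∃; _×_; _,_; proj₁; proj₂)
open import Data.Sum using (_⊎_; inj₁; inj₂)
import Data.Sum as Sum
open import Data.Sum.Function.Propositional using (_⊎-↔_)
open import Data.Vec using (_∷_; here; there; tabulate)
open import Data.Vec.Properties using (lookup∘tabulate; lookup⇒[]=; []=⇒lookup)
open import Function using (_∘_; _↔_; Inverse)
open import Function.Definitions using (Injective)
open import Function.Properties.Inverse using (↔-refl; ↔-trans)
open import Relation.Binary.PropositionalEquality
open import Relation.Nullary using (¬_; Dec; yes; no; does; map′; ¬?; _×-dec_; from-yes; from-no)
open import Relation.Nullary.Decidable using (dec-true; decidable-stable)

open import Defs

private variable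
  k m n N : ℕ
  p q : Subset n
  x : Fin n

-- Cardinalities of subsets

∣p∪⁅x⁆∣≡1+∣p∣ : x ∉ p → ∣ p ∪ ⁅ x ⁆ ∣ ≡ suc ∣ p ∣
∣p∪⁅x⁆∣≡1+∣p∣ {x = zero}  {p = inside ∷ p}  x∉p = ⊥-elim (x∉p here)
∣p∪⁅x⁆∣≡1+∣p∣ {x = zero}  {p = outside ∷ p} x∉p = cong (suc ∘ ∣_∣) (∪-identityʳ p)
∣p∪⁅x⁆∣≡1+∣p∣ {x = suc x} {p = inside ∷ p}  x∉p = cong suc (∣p∪⁅x⁆∣≡1+∣p∣ (x∉p ∘ there))
∣p∪⁅x⁆∣≡1+∣p∣ {x = suc x} {p = outside ∷ p} x∉p = ∣p∪⁅x⁆∣≡1+∣p∣ (x∉p ∘ there)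

x∈p⇒∣p∣≡1+∣p-x∣ : x ∈ p → ∣ p ∣ ≡ suc ∣ p - x ∣
x∈p⇒∣p∣≡1+∣p-x∣ {p = inside ∷ p}  here        = cong (suc ∘ ∣_∣) (sym (p─⊥≡p p))
x∈p⇒∣p∣≡1+∣p-x∣ {p = inside ∷ p}  (there x∈p) = cong suc (x∈p⇒∣p∣≡1+∣p-x∣ x∈p)
x∈p⇒∣p∣≡1+∣p-x∣ {p = outside ∷ p} (there x∈p) = x∈p⇒∣p∣≡1+∣p-x∣ x∈p

x∉p-x : (p : Subset n) (x : Fin n) → x ∉ p - x
x∉p-x (_ ∷ p) (suc x) (there x∈p-x) = x∉p-x p x x∈p-x

∣p∣<∣q∣⇒q⊈p : ∣ p ∣ < ∣ q ∣ → ∃ λ x → x ∈ q × x ∉ p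
∣p∣<∣q∣⇒q⊈p {p = s ∷ p} {q = outside ∷ q} ∣p∣<∣q∣ with ∣p∣<∣q∣⇒q⊈p (≤-<-trans (∣p∣≤∣x∷p∣ s p) ∣p∣<∣q∣)
... | x , x∈q , x∉p = suc x , there x∈q , x∉p ∘ drop-there
∣p∣<∣q∣⇒q⊈p {p = outside ∷ p} {q = inside ∷ q} ∣p∣<∣q∣ = zero , here , λ ()
∣p∣<∣q∣⇒q⊈p {p = inside ∷ p} {q = inside ∷ q} (s≤s ∣p∣<∣q∣) with ∣p∣<∣q∣⇒q⊈p ∣p∣<∣q∣
... | x , x∈q , x∉p = suc x , there x∈q , x∉p ∘ drop-there

p⊆q⇒∣q∣≤∣p∣⇒q⊆p : p ⊆ q → ∣ q ∣ ≤ ∣ p ∣ → q ⊆ p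
p⊆q⇒∣q∣≤∣p∣⇒q⊆p {p = p} p⊆q ∣q∣≤∣p∣ {x} x∈q with x ∈? p
... | yes x∈p = x∈p
... | no  x∉p = ⊥-elim (<⇒≱ (p⊂q⇒∣p∣<∣q∣ (p⊆q , x , x∈q , x∉p)) ∣q∣≤∣p∣)

p⊆q⇒p≢q⇒∣p∣<∣q∣ : p ⊆ q → p ≢ q → ∣ p ∣ < ∣ q ∣
p⊆q⇒p≢q⇒∣p∣<∣q∣ {p = p} {q} p⊆q p≢q with ∣ p ∣ <? ∣ q ∣
... | yes ∣p∣<∣q∣ = ∣p∣<∣q∣
... | no  ∣p∣≮∣q∣ = ⊥-elim (p≢q (⊆-antisym p⊆q (p⊆q⇒∣q∣≤∣p∣⇒q⊆p p⊆q (≮⇒≥ ∣p∣≮∣q∣))))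

∣p∣≡2⇒∃x≢y : ∣ p ∣ ≡ 2 → ∃ λ x → ∃ λ y → x ∈ p × y ∈ p × x ≢ y
∣p∣≡2⇒∃x≢y {n} {p} ∣p∣≡2
  with x , x∈p , _ ← ∣p∣<∣q∣⇒q⊈p {p = ⊥} {q = p} (subst₂ _<_ (sym (∣⊥∣≡0 n)) (sym ∣p∣≡2) (s≤s z≤n))
  with y , y∈p , y∉⁅x⁆ ← ∣p∣<∣q∣⇒q⊈p {p = ⁅ x ⁆} {q = p} (subst₂ _<_ (sym (∣⁅x⁆∣≡1 x)) (sym ∣p∣≡2) ≤-refl)
  = x , y , x∈p , y∈p , λ x≡y → y∉⁅x⁆ (subst (_∈ ⁅ x ⁆) x≡y (x∈⁅x⁆ x))

injective⇒≤∣p∣ : (f : Fin k → Fin n) → Injective _≡_ _≡_ f → (∀ i → f i ∈ p) → k ≤ ∣ p ∣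
injective⇒≤∣p∣ {zero}  f _     _   = z≤n
injective⇒≤∣p∣ {suc k} {p = p} f f-inj f∈p = begin
  suc k                 ≤⟨ s≤s (injective⇒≤∣p∣ (f ∘ suc) (Finₚ.suc-injective ∘ f-inj) f[1+i]∈p-f0) ⟩
  suc ∣ p - f zero ∣    ≡⟨ sym (x∈p⇒∣p∣≡1+∣p-x∣ (f∈p zero)) ⟩
  ∣ p ∣                 ∎
  where
  open ≤-Reasoning
  f[1+i]∈p-f0 : ∀ i → f (suc i) ∈ p - f zero
  f[1+i]∈p-f0 i = x∈p∧x≢y⇒x∈p-y (f∈p (suc i)) (Finₚ.0≢1+n ∘ sym ∘ f-inj)

covered⇒∣p∣≤k : (f : Fin k → Fin n) → (∀ {y} → y ∈ p → ∃ λ i → f i ≡ y) → ∣ p ∣ ≤ k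
covered⇒∣p∣≤k {zero} {n} {p} f covers =
  ≤-reflexive (trans (cong ∣_∣ (Empty-unique λ (_ , y∈p) → ¬Fin0 (proj₁ (covers y∈p)))) (∣⊥∣≡0 n))
  where open Finₚ using (¬Fin0)
covered⇒∣p∣≤k {suc k} {p = p} f covers = begin
  ∣ p ∣               ≤⟨ ∣p∣≤1+∣p-x∣ (f zero) ⟩
  suc ∣ p - f zero ∣  ≤⟨ s≤s (covered⇒∣p∣≤k (f ∘ suc) covers-p-f0) ⟩
  suc k               ∎
  where
  open ≤-Reasoning
  ∣p∣≤1+∣p-x∣ : ∀ x → ∣ p ∣ ≤ suc ∣ p - x ∣
  ∣p∣≤1+∣p-x∣ x with x ∈? p
  ... | yes x∈p = ≤-reflexive (x∈p⇒∣p∣≡1+∣p-x∣ x∈p)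
  ... | no  x∉p = m≤n⇒m≤1+n (p⊆q⇒∣p∣≤∣q∣ {p = p} {q = p - x} λ y∈p → x∈p∧x≢y⇒x∈p-y y∈p λ { refl → x∉p y∈p })
  covers-p-f0 : ∀ {y} → y ∈ p - f zero → ∃ λ i → f (suc i) ≡ y
  covers-p-f0 {y} y∈p-f0 with covers (p─q⊆p p ⁅ f zero ⁆ y∈p-f0)
  ... | zero  , refl = ⊥-elim (x∉p-x p (f zero) y∈p-f0)
  ... | suc i , fi≡y = i , fi≡y

uncovered-element : (f : Fin k → Fin n) → k < ∣ p ∣ → ∃ λ y → y ∈ p × ∀ i → f i ≢ y
uncovered-element {p = p} f k<∣p∣
  with Finₚ.any? (λ y → y ∈? p ×-dec Finₚ.all? (λ i → ¬? (f i Finₚ.≟ y)))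
... | yes (y , y∈p , fi≢y) = y , y∈p , fi≢y
... | no ∄y = ⊥-elim (<⇒≱ k<∣p∣ (covered⇒∣p∣≤k f covers))
  where
  covers : ∀ {y} → y ∈ p → ∃ λ i → f i ≡ y
  covers {y} y∈p = decidable-stable (Finₚ.any? (λ i → f i Finₚ.≟ y))
                     λ ∄i → ∄y (y , y∈p , λ i fi≡y → ∄i (i , fi≡y))

injective⇒covers : (f : Fin k → Fin n) → Injective _≡_ _≡_ f → (∀ i → f i ∈ p) → ∣ p ∣ ≤ k →
                   ∀ {y} → y ∈ p → ∃ λ i → f i ≡ y
injective⇒covers f f-inj f∈p ∣p∣≤k {y} y∈p =
  decidable-stable (Finₚ.any? (λ i → f i Finₚ.≟ y)) λ ∄i →
    <⇒≱ (<-≤-trans (x∈p⇒∣p-x∣<∣p∣ y∈p) ∣p∣≤k)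
        (injective⇒≤∣p∣ f f-inj (λ i → x∈p∧x≢y⇒x∈p-y (f∈p i) (λ fi≡y → ∄i (i , fi≡y))))

∁⁅x⁆-injective : ∀ {x y : Fin n} → ∁ ⁅ x ⁆ ≡ ∁ ⁅ y ⁆ → x ≡ y
∁⁅x⁆-injective {x = x} {y} ∁⁅x⁆≡∁⁅y⁆ with x Finₚ.≟ y
... | yes x≡y = x≡y
... | no  x≢y = ⊥-elim (x∈p⇒x∉∁p (x∈⁅x⁆ x) (subst (x ∈_) (sym ∁⁅x⁆≡∁⁅y⁆) (x∉p⇒x∈∁p (x≢y⇒x∉⁅y⁆ x≢y))))

⁅x⁆-injective : ∀ {x y : Fin n} → ⁅ x ⁆ ≡ ⁅ y ⁆ → x ≡ y
⁅x⁆-injective {x = x} {y} ⁅x⁆≡⁅y⁆ = x∈⁅y⁆⇒x≡y y (subst (x ∈_) ⁅x⁆≡⁅y⁆ (x∈⁅x⁆ x))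

∣⁅x⁆∪⁅y⁆∣≡2 : ∀ {x y : Fin n} → x ≢ y → ∣ ⁅ x ⁆ ∪ ⁅ y ⁆ ∣ ≡ 2
∣⁅x⁆∪⁅y⁆∣≡2 {x = x} x≢y = trans (∣p∪⁅x⁆∣≡1+∣p∣ (x≢y⇒x∉⁅y⁆ (x≢y ∘ sym))) (cong suc (∣⁅x⁆∣≡1 x))

∈⁅a⁆∪⁅b⁆∪⁅c⁆⁺ : ∀ {x a b c : Fin n} → x ≡ a ⊎ x ≡ b ⊎ x ≡ c → x ∈ ⁅ a ⁆ ∪ ⁅ b ⁆ ∪ ⁅ c ⁆
∈⁅a⁆∪⁅b⁆∪⁅c⁆⁺ (inj₁ refl)        = x∈p∪q⁺ (inj₁ (x∈⁅x⁆ _))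
∈⁅a⁆∪⁅b⁆∪⁅c⁆⁺ (inj₂ (inj₁ refl)) = x∈p∪q⁺ (inj₂ (x∈p∪q⁺ (inj₁ (x∈⁅x⁆ _))))
∈⁅a⁆∪⁅b⁆∪⁅c⁆⁺ (inj₂ (inj₂ refl)) = x∈p∪q⁺ (inj₂ (x∈p∪q⁺ (inj₂ (x∈⁅x⁆ _))))

∈⁅a⁆∪⁅b⁆∪⁅c⁆⁻ : ∀ {x : Fin n} a b c → x ∈ ⁅ a ⁆ ∪ ⁅ b ⁆ ∪ ⁅ c ⁆ → x ≡ a ⊎ x ≡ b ⊎ x ≡ c
∈⁅a⁆∪⁅b⁆∪⁅c⁆⁻ a b c x∈abc with x∈p∪q⁻ ⁅ a ⁆ (⁅ b ⁆ ∪ ⁅ c ⁆) x∈abc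
... | inj₁ x∈a = inj₁ (x∈⁅y⁆⇒x≡y a x∈a)
... | inj₂ x∈bc with x∈p∪q⁻ ⁅ b ⁆ ⁅ c ⁆ x∈bc
...   | inj₁ x∈b = inj₂ (inj₁ (x∈⁅y⁆⇒x≡y b x∈b))
...   | inj₂ x∈c = inj₂ (inj₂ (x∈⁅y⁆⇒x≡y c x∈c))

∣p∣≤k-by-member : (∀ {x} → x ∈ p → ∣ p ∣ ≤ k) → ∣ p ∣ ≤ k
∣p∣≤k-by-member {n} {p} {k} bound with nonempty? p
... | yes (_ , x∈p) = bound x∈p
... | no  empty     = subst (λ q → ∣ q ∣ ≤ k) (sym (Empty-unique empty)) (subst (_≤ k) (sym (∣⊥∣≡0 n)) z≤n)

-- Strictly monotone ranks on Q_k

StrictlyMonotone : (Subset k → ℕ) → Set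
StrictlyMonotone r = ∀ {x y} → x ⊂ y → r x < r y

module _ {r : Subset k → ℕ} (r-mono : StrictlyMonotone r) where

  ∣x∣≤r : ∀ x → ∣ x ∣ ≤ r x
  ∣x∣≤r x = ≤r-by-size ∣ x ∣ x refl
    where
    ≤r-by-size : ∀ t x → ∣ x ∣ ≡ t → t ≤ r x
    ≤r-by-size zero    x _ = z≤n
    ≤r-by-size (suc t) x ∣x∣≡1+t
      with a , a∈x , _ ← ∣p∣<∣q∣⇒q⊈p {p = ⊥} {q = x} (subst₂ _<_ (sym (∣⊥∣≡0 k)) (sym ∣x∣≡1+t) (s≤s z≤n))
      = ≤-<-trans (≤r-by-size t (x - a) (suc-injective (trans (sym (x∈p⇒∣p∣≡1+∣p-x∣ a∈x)) ∣x∣≡1+t)))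
                  (r-mono (x∈p⇒p-x⊂p a∈x))

  r≤∣x∣ : r ⊤ ≤ k → ∀ x → r x ≤ ∣ x ∣
  r≤∣x∣ r⊤≤k x = +-cancelʳ-≤ (k ∸ ∣ x ∣) (r x) ∣ x ∣ (begin
    r x + (k ∸ ∣ x ∣)   ≤⟨ r+t≤r⊤ (k ∸ ∣ x ∣) x (m+[n∸m]≡n (∣p∣≤n x)) ⟩
    r ⊤                 ≤⟨ r⊤≤k ⟩
    k                   ≡⟨ m+[n∸m]≡n (∣p∣≤n x) ⟨
    ∣ x ∣ + (k ∸ ∣ x ∣) ∎)
    where
    open ≤-Reasoning
    r+t≤r⊤ : ∀ t x → ∣ x ∣ + t ≡ k → r x + t ≤ r ⊤
    r+t≤r⊤ zero x ∣x∣+0≡k =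
      ≤-reflexive (trans (+-identityʳ (r x)) (cong r (∣p∣≡n⇒p≡⊤ (trans (sym (+-identityʳ ∣ x ∣)) ∣x∣+0≡k))))
    r+t≤r⊤ (suc t) x ∣x∣+1+t≡k
      with a , _ , a∉x ← ∣p∣<∣q∣⇒q⊈p {p = x} {q = ⊤}
             (subst (∣ x ∣ <_) (sym (∣⊤∣≡n k)) (subst (∣ x ∣ <_) ∣x∣+1+t≡k (m<m+n ∣ x ∣ (s≤s z≤n))))
      = begin
        r x + suc t           ≡⟨ +-suc (r x) t ⟩
        suc (r x) + t         ≤⟨ +-monoˡ-≤ t (r-mono (p⊆p∪q ⁅ a ⁆ , a , q⊆p∪q x ⁅ a ⁆ (x∈⁅x⁆ a) , a∉x)) ⟩
        r (x ∪ ⁅ a ⁆) + t     ≤⟨ r+t≤r⊤ t (x ∪ ⁅ a ⁆) ∣x∪⁅a⁆∣+t≡k ⟩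
        r ⊤                   ∎
      where
      ∣x∪⁅a⁆∣+t≡k : ∣ x ∪ ⁅ a ⁆ ∣ + t ≡ k
      ∣x∪⁅a⁆∣+t≡k = trans (cong (_+ t) (∣p∪⁅x⁆∣≡1+∣p∣ a∉x)) (trans (sym (+-suc ∣ x ∣ t)) ∣x∣+1+t≡k)

embedding-rank-mono : (F : Subset N → Set) (ρ : Subset N → ℕ) →
  (∀ {X Y} → F X → F Y → ∣ X ∣ < ∣ Y ∣ → ρ X < ρ Y) →
  ((f , f∈F , f-inj , f-mono) : WeakSubposetOf k N F) → StrictlyMonotone (ρ ∘ f)
embedding-rank-mono F ρ ρ-mono (f , f∈F , f-inj , f-mono) {x} {y} x⊂y@(x⊆y , _) =
  ρ-mono (f∈F x) (f∈F y) (p⊆q⇒p≢q⇒∣p∣<∣q∣ (f-mono x y x⊆y) (λ fx≡fy → ⊂-irref (f-inj fx≡fy) x⊂y))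

-- Colourings from line systems

RamseyColouring : (N n m : ℕ) → Set
RamseyColouring N n m = Σ (Subset N → Bool) λ c →
  (¬ WeakSubposetOf m N (λ X → c X ≡ true)) × (¬ WeakSubposetOf n N (λ X → c X ≡ false))

swap-colours : RamseyColouring N n m → RamseyColouring N m n
swap-colours (c , no-blue-Qm , no-red-Qn) =
    not ∘ c
  , (λ (f , blue , inj , mono) → no-red-Qn (f , not-injective {y = false} ∘ blue , inj , mono))
  , (λ (f , red  , inj , mono) → no-blue-Qm (f , not-injective {y = true} ∘ red , inj , mono))

record LineSystem (N n m : ℕ) : Set₁ where
  field
    Collinear                : Subset N → Set
    collinear?               : ∀ X → Dec (Collinear X)
    collinear-⊆              : ∀ {X Y} → X ⊆ Y → Collinear Y → Collinear X
    line                     : Fin N → Fin N → Subset N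
    collinear⇒⊆line          : ∀ {a b X} → a ≢ b → a ∈ X → b ∈ X → Collinear X → X ⊆ line a b
    ∣line∣≤1+m               : ∀ a b → ∣ line a b ∣ ≤ suc m
    #directions              : ℕ
    #directions<n            : #directions < n
    direction                : Fin N → Fin N → ℕ
    direction<#directions    : ∀ {q y} → q ≢ y → direction q y < #directions
    sameDirection⇒collinear  : ∀ {q y z} → q ≢ y → q ≢ z → y ≢ z → direction q y ≡ direction q z →
                               Collinear (⁅ q ⁆ ∪ ⁅ y ⁆ ∪ ⁅ z ⁆)

-- The sizes a red set, resp. a blue set, can have, numbered consecutively.
redRank : ℕ → ℕ
redRank 0             = 0
redRank 1             = 1
redRank (suc (suc s)) = suc s

redRank-mono : ∀ {s t} → s < t → t ≢ 2 → redRank s < redRank t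
redRank-mono {0}           {1}                 _               _   = s≤s z≤n
redRank-mono {0}           {suc (suc (suc _))} _               _   = s≤s z≤n
redRank-mono {1}           {suc (suc (suc _))} _               _   = s≤s (s≤s z≤n)
redRank-mono {suc (suc _)} {suc (suc _)}       (s≤s (s≤s s<t)) _   = s≤s s<t
redRank-mono {_}           {2}                 _               t≢2 = ⊥-elim (t≢2 refl)
redRank-mono {1}           {1}                 (s≤s ())        _

redRank≤ : ∀ {s} → s ≤ suc n → 1 ≤ n → redRank s ≤ n
redRank≤ {s = 0}           _         _   = z≤n
redRank≤ {s = 1}           _         1≤n = 1≤n
redRank≤ {s = suc (suc _)} (s≤s s≤n) _   = s≤n

redRank⁻¹ : ∀ {s t} → 2 ≤ t → redRank s ≡ t → s ≡ suc t
redRank⁻¹ {suc (suc _)} _ refl = refl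
redRank⁻¹ {1} (s≤s ()) refl

module _ (n : ℕ) where

  BlueSize : ℕ → Set
  BlueSize s = s ≡ 2 ⊎ s ≡ 3 ⊎ n + 2 ≤ s

  blueRank : ℕ → ℕ
  blueRank 0                         = 0
  blueRank 1                         = 0
  blueRank 2                         = 0
  blueRank 3                         = 1
  blueRank s@(suc (suc (suc (suc _)))) = s ∸ n

  module _ (3≤n : 3 ≤ n) where

    n+2≰s : ∀ {s} → s ≤ 3 → ¬ n + 2 ≤ s
    n+2≰s s≤3 n+2≤s = from-no (5 ≤? 3) (≤-trans (≤-trans (+-monoˡ-≤ 2 3≤n) n+2≤s) s≤3)

    blueRank-large : ∀ {s} → n + 2 ≤ s → blueRank s ≡ s ∸ n
    blueRank-large {0}                       n+2≤s = ⊥-elim (n+2≰s z≤n n+2≤s)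
    blueRank-large {1}                       n+2≤s = ⊥-elim (n+2≰s (s≤s z≤n) n+2≤s)
    blueRank-large {2}                       n+2≤s = ⊥-elim (n+2≰s (s≤s (s≤s z≤n)) n+2≤s)
    blueRank-large {3}                       n+2≤s = ⊥-elim (n+2≰s ≤-refl n+2≤s)
    blueRank-large {suc (suc (suc (suc _)))} _     = refl

    2≤blueRank : ∀ {s} → n + 2 ≤ s → 2 ≤ blueRank s
    2≤blueRank {s} n+2≤s = begin
      2           ≡⟨ m+n∸m≡n n 2 ⟨
      n + 2 ∸ n   ≤⟨ ∸-monoˡ-≤ n n+2≤s ⟩
      s ∸ n       ≡⟨ blueRank-large n+2≤s ⟨
      blueRank s  ∎
      where open ≤-Reasoning

    blueRank-mono : ∀ {s t} → BlueSize s → BlueSize t → s < t → blueRank s < blueRank t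
    blueRank-mono (inj₁ refl)        (inj₂ (inj₁ refl)) _   = s≤s z≤n
    blueRank-mono (inj₁ refl)        (inj₂ (inj₂ big))  _   = ≤-trans (s≤s z≤n) (2≤blueRank big)
    blueRank-mono (inj₂ (inj₁ refl)) (inj₂ (inj₂ big))  _   = 2≤blueRank big
    blueRank-mono {s} {t} (inj₂ (inj₂ big)) (inj₂ (inj₂ big′)) s<t
      rewrite blueRank-large big | blueRank-large big′ = ∸-monoˡ-< s<t (≤-trans (m≤m+n n 2) big)
    blueRank-mono (inj₁ refl)        (inj₁ refl)        2<2 = ⊥-elim (<-irrefl refl 2<2)
    blueRank-mono (inj₂ (inj₁ refl)) (inj₂ (inj₁ refl)) 3<3 = ⊥-elim (<-irrefl refl 3<3)
    blueRank-mono (inj₂ (inj₁ refl)) (inj₁ refl)        3<2 = ⊥-elim (<-asym 3<2 (n<1+n 2))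
    blueRank-mono (inj₂ (inj₂ big))  (inj₁ refl)        s<2 = ⊥-elim (n+2≰s (<⇒≤ (≤-trans s<2 (n≤1+n 2))) big)
    blueRank-mono (inj₂ (inj₂ big))  (inj₂ (inj₁ refl)) s<3 = ⊥-elim (n+2≰s (<⇒≤ s<3) big)

    blueRank≤m : ∀ {s m} → 1 ≤ m → s ≤ n + m → blueRank s ≤ m
    blueRank≤m {0}                        _   _       = z≤n
    blueRank≤m {1}                        _   _       = z≤n
    blueRank≤m {2}                        _   _       = z≤n
    blueRank≤m {3}                        1≤m _       = 1≤m
    blueRank≤m {suc (suc (suc (suc s)))} {m} _ s≤n+m = begin
      suc (suc (suc (suc s))) ∸ n   ≤⟨ ∸-monoˡ-≤ n s≤n+m ⟩
      n + m ∸ n                     ≡⟨ m+n∸m≡n n m ⟩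
      m                             ∎
      where open ≤-Reasoning

module Colouring {n m : ℕ} (L : LineSystem (n + m) n m) (3≤n : 3 ≤ n) (1≤m : 1 ≤ m) where
  open LineSystem L

  sizeColour : ℕ → Bool → Bool
  sizeColour 0                           _         = false
  sizeColour 1                           _         = false
  sizeColour 2                           _         = true
  sizeColour 3                           collinear = collinear
  sizeColour s@(suc (suc (suc (suc _)))) _         = n + 2 ≤ᵇ s

  colour : Subset (n + m) → Bool
  colour X = sizeColour ∣ X ∣ (does (collinear? X))

  Blue Red : Subset (n + m) → Set
  Blue X = colour X ≡ true
  Red  X = colour X ≡ false

  blue-size : ∀ {X} → Blue X → ∣ X ∣ ≡ 2 ⊎ (∣ X ∣ ≡ 3 × Collinear X) ⊎ n + 2 ≤ ∣ X ∣
  blue-size {X} blue with ∣ X ∣ | collinear? X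
  blue-size ()   | 0 | _
  blue-size ()   | 1 | _
  blue-size _    | 2 | _ = inj₁ refl
  blue-size _    | 3 | yes c = inj₂ (inj₁ (refl , c))
  blue-size ()   | 3 | no _
  blue-size blue | s@(suc (suc (suc (suc _)))) | _ =
    inj₂ (inj₂ (≤ᵇ⇒≤ (n + 2) s (subst T (sym blue) _)))

  red-size : ∀ {X} → Red X → ∣ X ∣ ≢ 2 × ∣ X ∣ ≤ suc n
  red-size {X} red with ∣ X ∣ | collinear? X
  red-size _  | 0 | _ = (λ ()) , z≤n
  red-size _  | 1 | _ = (λ ()) , s≤s z≤n
  red-size () | 2 | _
  red-size () | 3 | yes _
  red-size _  | 3 | no _ = (λ ()) , m≤n⇒m≤1+n 3≤n
  red-size red | s@(suc (suc (suc (suc _)))) | _ =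
    (λ ()) , ≤-pred (subst (s <_) (+-comm n 2) (≰⇒> (subst T red ∘ ≤⇒≤ᵇ)))

  collinear-triple-blue : ∀ {X} → ∣ X ∣ ≡ 3 → Collinear X → Blue X
  collinear-triple-blue {X} ∣X∣≡3 c with ∣ X ∣ | collinear? X
  ... | _ | no ¬c = ⊥-elim (¬c c)
  ... | 3 | yes _ = refl

  module RedCopy (f : Subset n → Subset (n + m)) (f-red : ∀ x → Red (f x))
                 (f-inj : Injective _≡_ _≡_ f) (f-mono : ∀ x y → x ⊆ y → f x ⊆ f y) where

    ∣fx∣≡1+∣x∣ : ∀ x → 2 ≤ ∣ x ∣ → ∣ f x ∣ ≡ suc ∣ x ∣
    ∣fx∣≡1+∣x∣ x 2≤∣x∣ = redRank⁻¹ 2≤∣x∣ (≤-antisym (r≤∣x∣ rank-mono rank⊤≤n x) (∣x∣≤r rank-mono x))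
      where
      rank-mono : StrictlyMonotone (redRank ∘ ∣_∣ ∘ f)
      rank-mono = embedding-rank-mono Red (redRank ∘ ∣_∣)
                    (λ {_} {Y} _ Y-red ∣X∣<∣Y∣ → redRank-mono ∣X∣<∣Y∣ (proj₁ (red-size {Y} Y-red)))
                    (f , f-red , f-inj , f-mono)
      rank⊤≤n : redRank ∣ f ⊤ ∣ ≤ n
      rank⊤≤n = redRank≤ (proj₂ (red-size {f ⊤} (f-red ⊤))) (≤-trans (s≤s z≤n) 3≤n)

    D : Subset (n + m)
    D = f ⊤

    ∣D∣≡1+n : ∣ D ∣ ≡ suc n
    ∣D∣≡1+n = trans (∣fx∣≡1+∣x∣ ⊤ (subst (2 ≤_) (sym (∣⊤∣≡n n)) (≤-trans (n≤1+n 2) 3≤n))) (cong suc (∣⊤∣≡n n))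

    fx⊆D : ∀ x → f x ⊆ D
    fx⊆D x = f-mono x ⊤ ⊆⊤

    ∣f∁⁅l⁆∣≡n : ∀ l → ∣ f (∁ ⁅ l ⁆) ∣ ≡ n
    ∣f∁⁅l⁆∣≡n l = trans (∣fx∣≡1+∣x∣ (∁ ⁅ l ⁆) 2≤∣∁⁅l⁆∣) (trans (cong suc ∣∁⁅l⁆∣≡n∸1) (m+[n∸m]≡n 1≤n))
      where
      1≤n = ≤-trans (s≤s z≤n) 3≤n
      ∣∁⁅l⁆∣≡n∸1 : ∣ ∁ ⁅ l ⁆ ∣ ≡ n ∸ 1
      ∣∁⁅l⁆∣≡n∸1 = trans (∣∁p∣≡n∸∣p∣ ⁅ l ⁆) (cong (n ∸_) (∣⁅x⁆∣≡1 l))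
      2≤∣∁⁅l⁆∣ : 2 ≤ ∣ ∁ ⁅ l ⁆ ∣
      2≤∣∁⁅l⁆∣ = subst (2 ≤_) (sym ∣∁⁅l⁆∣≡n∸1) (∸-monoˡ-≤ 1 3≤n)

    -- Opaque, so that the decision procedures computing these witnesses are never unfolded during type checking.
    opaque
      missing : ∀ l → ∃ λ y → y ∈ D × y ∉ f (∁ ⁅ l ⁆)
      missing l = ∣p∣<∣q∣⇒q⊈p (subst₂ _<_ (sym (∣f∁⁅l⁆∣≡n l)) (sym ∣D∣≡1+n) ≤-refl)

      d : Fin n → Fin (n + m)
      d l = proj₁ (missing l)

      d∈D : ∀ l → d l ∈ D
      d∈D l = proj₁ (proj₂ (missing l))

      d∉f∁⁅l⁆ : ∀ l → d l ∉ f (∁ ⁅ l ⁆)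
      d∉f∁⁅l⁆ l = proj₂ (proj₂ (missing l))

    f∁⁅l⁆≡D-d : ∀ l → f (∁ ⁅ l ⁆) ≡ D - d l
    f∁⁅l⁆≡D-d l = ⊆-antisym f∁⁅l⁆⊆D-d (p⊆q⇒∣q∣≤∣p∣⇒q⊆p f∁⁅l⁆⊆D-d (≤-reflexive ∣D-d∣≡∣f∁⁅l⁆∣))
      where
      f∁⁅l⁆⊆D-d : f (∁ ⁅ l ⁆) ⊆ D - d l
      f∁⁅l⁆⊆D-d y∈f∁⁅l⁆ = x∈p∧x≢y⇒x∈p-y (fx⊆D _ y∈f∁⁅l⁆) λ { refl → d∉f∁⁅l⁆ l y∈f∁⁅l⁆ }
      ∣D-d∣≡∣f∁⁅l⁆∣ : ∣ D - d l ∣ ≡ ∣ f (∁ ⁅ l ⁆) ∣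
      ∣D-d∣≡∣f∁⁅l⁆∣ = suc-injective (begin
        suc ∣ D - d l ∣         ≡⟨ x∈p⇒∣p∣≡1+∣p-x∣ (d∈D l) ⟨
        ∣ D ∣                   ≡⟨ ∣D∣≡1+n ⟩
        suc n                   ≡⟨ cong suc (∣f∁⁅l⁆∣≡n l) ⟨
        suc ∣ f (∁ ⁅ l ⁆) ∣     ∎)
        where open ≡-Reasoning

    d-injective : Injective _≡_ _≡_ d
    d-injective {i} {j} di≡dj = ∁⁅x⁆-injective (f-inj (begin
      f (∁ ⁅ i ⁆)   ≡⟨ f∁⁅l⁆≡D-d i ⟩
      D - d i       ≡⟨ cong (D -_) di≡dj ⟩
      D - d j       ≡⟨ f∁⁅l⁆≡D-d j ⟨
      f (∁ ⁅ j ⁆)   ∎))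
      where open ≡-Reasoning

    d∉f⁅i⁆∪⁅j⁆ : ∀ {i j l} → l ≢ i → l ≢ j → d l ∉ f (⁅ i ⁆ ∪ ⁅ j ⁆)
    d∉f⁅i⁆∪⁅j⁆ {i} {j} {l} l≢i l≢j = d∉f∁⁅l⁆ l ∘ f-mono _ _ ⁅i⁆∪⁅j⁆⊆∁⁅l⁆
      where
      ⁅i⁆∪⁅j⁆⊆∁⁅l⁆ : ⁅ i ⁆ ∪ ⁅ j ⁆ ⊆ ∁ ⁅ l ⁆
      ⁅i⁆∪⁅j⁆⊆∁⁅l⁆ y∈ij with x∈p∪q⁻ ⁅ i ⁆ ⁅ j ⁆ y∈ij
      ... | inj₁ y∈i = x∉p⇒x∈∁p (x≢y⇒x∉⁅y⁆ λ y≡l → l≢i (trans (sym y≡l) (x∈⁅y⁆⇒x≡y i y∈i)))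
      ... | inj₂ y∈j = x∉p⇒x∈∁p (x≢y⇒x∉⁅y⁆ λ y≡l → l≢j (trans (sym y≡l) (x∈⁅y⁆⇒x≡y j y∈j)))

    opaque
      extra : ∃ λ o → o ∈ D × ∀ l → d l ≢ o
      extra = uncovered-element d (subst (n <_) (sym ∣D∣≡1+n) ≤-refl)

      o : Fin (n + m)
      o = proj₁ extra

      o∈D : o ∈ D
      o∈D = proj₁ (proj₂ extra)

      o≢d : ∀ l → o ≢ d l
      o≢d l = proj₂ (proj₂ extra) l ∘ sym

    D-o⊆image-d : ∀ {y} → y ∈ D → y ≢ o → ∃ λ l → d l ≡ y
    D-o⊆image-d y∈D y≢o =
      injective⇒covers d d-injective (λ l → x∈p∧x≢y⇒x∈p-y (d∈D l) (o≢d l ∘ sym))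
        (≤-reflexive ∣D-o∣≡n) (x∈p∧x≢y⇒x∈p-y y∈D y≢o)
      where
      ∣D-o∣≡n : ∣ D - o ∣ ≡ n
      ∣D-o∣≡n = suc-injective (trans (sym (x∈p⇒∣p∣≡1+∣p-x∣ o∈D)) ∣D∣≡1+n)

    f⁅i⁆∪⁅j⁆⊆⁅o,di,dj⁆ : ∀ i j → f (⁅ i ⁆ ∪ ⁅ j ⁆) ⊆ ⁅ o ⁆ ∪ ⁅ d i ⁆ ∪ ⁅ d j ⁆
    f⁅i⁆∪⁅j⁆⊆⁅o,di,dj⁆ i j {y} y∈fij with y Finₚ.≟ o
    ... | yes y≡o = ∈⁅a⁆∪⁅b⁆∪⁅c⁆⁺ (inj₁ y≡o)
    ... | no  y≢o with D-o⊆image-d (fx⊆D _ y∈fij) y≢o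
    ...   | l , refl with l Finₚ.≟ i | l Finₚ.≟ j
    ...     | yes l≡i | _       = ∈⁅a⁆∪⁅b⁆∪⁅c⁆⁺ (inj₂ (inj₁ (cong d l≡i)))
    ...     | no _    | yes l≡j = ∈⁅a⁆∪⁅b⁆∪⁅c⁆⁺ (inj₂ (inj₂ (cong d l≡j)))
    ...     | no l≢i  | no l≢j  = ⊥-elim (d∉f⁅i⁆∪⁅j⁆ l≢i l≢j y∈fij)

    blue-pair : ∃ λ i → ∃ λ j → Blue (f (⁅ i ⁆ ∪ ⁅ j ⁆))
    blue-pair
      with i , j , i<j , same ← Finₚ.pigeonhole #directions<n (λ l → fromℕ< (direction<#directions (o≢d l)))
      = i , j , collinear-triple-blue ∣fij∣≡3 (collinear-⊆ (f⁅i⁆∪⁅j⁆⊆⁅o,di,dj⁆ i j) collinear)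
      where
      i≢j : i ≢ j
      i≢j i≡j = <-irrefl (cong toℕ i≡j) i<j
      ∣fij∣≡3 : ∣ f (⁅ i ⁆ ∪ ⁅ j ⁆) ∣ ≡ 3
      ∣fij∣≡3 = trans (∣fx∣≡1+∣x∣ _ (≤-reflexive (sym (∣⁅x⁆∪⁅y⁆∣≡2 i≢j)))) (cong suc (∣⁅x⁆∪⁅y⁆∣≡2 i≢j))
      collinear : Collinear (⁅ o ⁆ ∪ ⁅ d i ⁆ ∪ ⁅ d j ⁆)
      collinear = sameDirection⇒collinear (o≢d i) (o≢d j) (i≢j ∘ d-injective)
        (Finₚ.fromℕ<-injective _ _ (direction<#directions (o≢d i)) (direction<#directions (o≢d j)) same)

  blue⇒¬red : ∀ {X} → Blue X → ¬ Red X
  blue⇒¬red blue red with () ← trans (sym blue) red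

  no-red-Qn : ¬ WeakSubposetOf n (n + m) Red
  no-red-Qn (f , f-red , f-inj , f-mono) with i , j , blue ← RedCopy.blue-pair f f-red f-inj f-mono
    = blue⇒¬red {f (⁅ i ⁆ ∪ ⁅ j ⁆)} blue (f-red (⁅ i ⁆ ∪ ⁅ j ⁆))

  module BlueCopy (f : Subset m → Subset (n + m)) (f-blue : ∀ x → Blue (f x))
                  (f-inj : Injective _≡_ _≡_ f) (f-mono : ∀ x y → x ⊆ y → f x ⊆ f y) where

    blueRank∣fx∣≤∣x∣ : ∀ x → blueRank n ∣ f x ∣ ≤ ∣ x ∣
    blueRank∣fx∣≤∣x∣ = r≤∣x∣ rank-mono (blueRank≤m n 3≤n 1≤m (∣p∣≤n (f ⊤)))
      where
      blueSize : ∀ {X} → Blue X → BlueSize n ∣ X ∣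
      blueSize {X} = Sum.map₂ (Sum.map₁ proj₁) ∘ blue-size {X}
      rank-mono : StrictlyMonotone (blueRank n ∘ ∣_∣ ∘ f)
      rank-mono = embedding-rank-mono Blue (blueRank n ∘ ∣_∣)
                    (λ {X} {Y} X-blue Y-blue → blueRank-mono n 3≤n (blueSize {X} X-blue) (blueSize {Y} Y-blue))
                    (f , f-blue , f-inj , f-mono)

    A : Subset (n + m)
    A = f ⊥

    blueRank∣A∣≤0 : blueRank n ∣ A ∣ ≤ 0
    blueRank∣A∣≤0 = subst (blueRank n ∣ A ∣ ≤_) (∣⊥∣≡0 m) (blueRank∣fx∣≤∣x∣ ⊥)

    ∣A∣≡2 : ∣ A ∣ ≡ 2
    ∣A∣≡2 with blue-size {A} (f-blue ⊥)
    ... | inj₁ ∣A∣≡2             = ∣A∣≡2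
    ... | inj₂ (inj₁ (∣A∣≡3 , _)) = ⊥-elim (1+n≰n (subst (λ s → blueRank n s ≤ 0) ∣A∣≡3 blueRank∣A∣≤0))
    ... | inj₂ (inj₂ large)       = ⊥-elim (1+n≰n (≤-trans (≤-trans (n≤1+n 1) (2≤blueRank n 3≤n large)) blueRank∣A∣≤0))

    X : Fin m → Subset (n + m)
    X i = f ⁅ i ⁆

    A⊆X : ∀ i → A ⊆ X i
    A⊆X i = f-mono ⊥ ⁅ i ⁆ (⊆-min ⁅ i ⁆)

    ∣A∣<∣X∣ : ∀ i → ∣ A ∣ < ∣ X i ∣
    ∣A∣<∣X∣ i = p⊆q⇒p≢q⇒∣p∣<∣q∣ (A⊆X i) (λ A≡X → ∉⊥ (subst (i ∈_) (sym (f-inj A≡X)) (x∈⁅x⁆ i)))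

    X-collinear-triple : ∀ i → ∣ X i ∣ ≡ 3 × Collinear (X i)
    X-collinear-triple i with blue-size {X i} (f-blue ⁅ i ⁆)
    ... | inj₁ ∣X∣≡2        = ⊥-elim (<-irrefl (trans ∣A∣≡2 (sym ∣X∣≡2)) (∣A∣<∣X∣ i))
    ... | inj₂ (inj₁ triple) = triple
    ... | inj₂ (inj₂ large)  = ⊥-elim (1+n≰n (≤-trans (2≤blueRank n 3≤n large)
                                (subst (blueRank n ∣ X i ∣ ≤_) (∣⁅x⁆∣≡1 i) (blueRank∣fx∣≤∣x∣ ⁅ i ⁆))))

    opaque
      two-points : ∃ λ x → ∃ λ y → x ∈ A × y ∈ A × x ≢ y
      two-points = ∣p∣≡2⇒∃x≢y {p = A} ∣A∣≡2

      a₁ a₂ : Fin (n + m)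
      a₁ = proj₁ two-points
      a₂ = proj₁ (proj₂ two-points)

      a₁∈A : a₁ ∈ A
      a₁∈A = proj₁ (proj₂ (proj₂ two-points))

      a₂∈A : a₂ ∈ A
      a₂∈A = proj₁ (proj₂ (proj₂ (proj₂ two-points)))

      a₁≢a₂ : a₁ ≢ a₂
      a₁≢a₂ = proj₂ (proj₂ (proj₂ (proj₂ two-points)))

    ℓ : Subset (n + m)
    ℓ = line a₁ a₂

    X⊆ℓ : ∀ i → X i ⊆ ℓ
    X⊆ℓ i = collinear⇒⊆line a₁≢a₂ (A⊆X i a₁∈A) (A⊆X i a₂∈A) (proj₂ (X-collinear-triple i))

    opaque
      new : ∀ i → ∃ λ y → y ∈ X i × y ∉ A
      new i = ∣p∣<∣q∣⇒q⊈p (∣A∣<∣X∣ i)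

      e : Fin m → Fin (n + m)
      e i = proj₁ (new i)

      e∈X : ∀ i → e i ∈ X i
      e∈X i = proj₁ (proj₂ (new i))

      e∉A : ∀ i → e i ∉ A
      e∉A i = proj₂ (proj₂ (new i))

    X≡A∪⁅e⁆ : ∀ i → X i ≡ A ∪ ⁅ e i ⁆
    X≡A∪⁅e⁆ i = ⊆-antisym (p⊆q⇒∣q∣≤∣p∣⇒q⊆p A∪⁅e⁆⊆X (≤-reflexive ∣X∣≡∣A∪⁅e⁆∣)) A∪⁅e⁆⊆X
      where
      A∪⁅e⁆⊆X : A ∪ ⁅ e i ⁆ ⊆ X i
      A∪⁅e⁆⊆X y∈ with x∈p∪q⁻ A ⁅ e i ⁆ y∈
      ... | inj₁ y∈A = A⊆X i y∈A
      ... | inj₂ y∈e = subst (_∈ X i) (sym (x∈⁅y⁆⇒x≡y (e i) y∈e)) (e∈X i)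
      ∣X∣≡∣A∪⁅e⁆∣ : ∣ X i ∣ ≡ ∣ A ∪ ⁅ e i ⁆ ∣
      ∣X∣≡∣A∪⁅e⁆∣ = trans (proj₁ (X-collinear-triple i)) (sym (trans (∣p∪⁅x⁆∣≡1+∣p∣ (e∉A i)) (cong suc ∣A∣≡2)))

    e-injective : Injective _≡_ _≡_ e
    e-injective {i} {j} ei≡ej = ⁅x⁆-injective (f-inj (begin
      X i             ≡⟨ X≡A∪⁅e⁆ i ⟩
      A ∪ ⁅ e i ⁆     ≡⟨ cong (λ y → A ∪ ⁅ y ⁆) ei≡ej ⟩
      A ∪ ⁅ e j ⁆     ≡⟨ X≡A∪⁅e⁆ j ⟨
      X j             ∎))
      where open ≡-Reasoning

    m≤∣ℓ-a₁-a₂∣ : m ≤ ∣ ℓ - a₁ - a₂ ∣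
    m≤∣ℓ-a₁-a₂∣ = injective⇒≤∣p∣ e e-injective λ i →
      x∈p∧x≢y⇒x∈p-y (x∈p∧x≢y⇒x∈p-y (X⊆ℓ i (e∈X i))
        (λ ei≡a₁ → e∉A i (subst (_∈ A) (sym ei≡a₁) a₁∈A)))
        (λ ei≡a₂ → e∉A i (subst (_∈ A) (sym ei≡a₂) a₂∈A))

    ∣ℓ-a₁-a₂∣<m : ∣ ℓ - a₁ - a₂ ∣ < m
    ∣ℓ-a₁-a₂∣<m = ≤-pred (begin
      suc (suc ∣ ℓ - a₁ - a₂ ∣)  ≡⟨ cong suc (x∈p⇒∣p∣≡1+∣p-x∣ a₂∈ℓ-a₁) ⟨
      suc ∣ ℓ - a₁ ∣             ≡⟨ x∈p⇒∣p∣≡1+∣p-x∣ a₁∈ℓ ⟨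
      ∣ ℓ ∣                      ≤⟨ ∣line∣≤1+m a₁ a₂ ⟩
      suc m                      ∎)
      where
      open ≤-Reasoning
      i₀ : Fin m
      i₀ = fromℕ< 1≤m
      a₁∈ℓ : a₁ ∈ ℓ
      a₁∈ℓ = X⊆ℓ i₀ (A⊆X i₀ a₁∈A)
      a₂∈ℓ-a₁ : a₂ ∈ ℓ - a₁
      a₂∈ℓ-a₁ = x∈p∧x≢y⇒x∈p-y (X⊆ℓ i₀ (A⊆X i₀ a₂∈A)) (a₁≢a₂ ∘ sym)

  no-blue-Qm : ¬ WeakSubposetOf m (n + m) Blue
  no-blue-Qm (f , f-blue , f-inj , f-mono) = <⇒≱ ∣ℓ-a₁-a₂∣<m m≤∣ℓ-a₁-a₂∣
    where open BlueCopy f f-blue f-inj f-mono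

  ramseyColouring : RamseyColouring (n + m) n m
  ramseyColouring = colour , no-blue-Qm , no-red-Qn

-- Arithmetic in ℤ_g

module Modular (g : ℕ) .{{_ : NonZero g}} where

  infixl 6 _⊕_ _⊖_

  _⊕_ : Fin g → Fin g → Fin g
  i ⊕ j = fromℕ< (m%n<n (toℕ i + toℕ j) g)

  _⊖_ : Fin g → Fin g → Fin g
  k ⊖ a = fromℕ< (m%n<n (toℕ k + (g ∸ toℕ a)) g)

  private
    [m+n%g]%g≡[m+n]%g : ∀ m n → (m + n % g) % g ≡ (m + n) % g
    [m+n%g]%g≡[m+n]%g m n = begin
      (m + n % g) % g              ≡⟨ %-distribˡ-+ m (n % g) g ⟩
      (m % g + n % g % g) % g      ≡⟨ cong (λ r → (m % g + r) % g) (m%n%n≡m%n n g) ⟩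
      (m % g + n % g) % g          ≡⟨ %-distribˡ-+ m n g ⟨
      (m + n) % g                  ∎
      where open ≡-Reasoning

    a+[x+[g∸a]]≡x+g : ∀ a x → a ≤ g → a + (x + (g ∸ a)) ≡ x + g
    a+[x+[g∸a]]≡x+g a x a≤g = begin
      a + (x + (g ∸ a))   ≡⟨ +-comm a _ ⟩
      x + (g ∸ a) + a     ≡⟨ +-assoc x (g ∸ a) a ⟩
      x + (g ∸ a + a)     ≡⟨ cong (x +_) (m∸n+n≡m a≤g) ⟩
      x + g               ∎
      where open ≡-Reasoning

    [x+g]%g≡x : ∀ (x : Fin g) → (toℕ x + g) % g ≡ toℕ x
    [x+g]%g≡x x = trans ([m+n]%n≡m%n (toℕ x) g) (m<n⇒m%n≡m (Finₚ.toℕ<n x))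

    toℕ-⊕ : ∀ i j → toℕ (i ⊕ j) ≡ (toℕ i + toℕ j) % g
    toℕ-⊕ i j = Finₚ.toℕ-fromℕ< _

    toℕ-⊖ : ∀ k a → toℕ (k ⊖ a) ≡ (toℕ k + (g ∸ toℕ a)) % g
    toℕ-⊖ k a = Finₚ.toℕ-fromℕ< _

  ⊕-comm : ∀ i j → i ⊕ j ≡ j ⊕ i
  ⊕-comm i j = Finₚ.toℕ-injective (begin
    toℕ (i ⊕ j)             ≡⟨ toℕ-⊕ i j ⟩
    (toℕ i + toℕ j) % g     ≡⟨ cong (_% g) (+-comm (toℕ i) (toℕ j)) ⟩
    (toℕ j + toℕ i) % g     ≡⟨ toℕ-⊕ j i ⟨
    toℕ (j ⊕ i)             ∎)
    where open ≡-Reasoning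

  ⊕-⊖ : ∀ a k → a ⊕ (k ⊖ a) ≡ k
  ⊕-⊖ a k = Finₚ.toℕ-injective (begin
    toℕ (a ⊕ (k ⊖ a))                        ≡⟨ toℕ-⊕ a (k ⊖ a) ⟩
    (toℕ a + toℕ (k ⊖ a)) % g                ≡⟨ cong (λ r → (toℕ a + r) % g) (toℕ-⊖ k a) ⟩
    (toℕ a + (toℕ k + (g ∸ toℕ a)) % g) % g  ≡⟨ [m+n%g]%g≡[m+n]%g (toℕ a) _ ⟩
    (toℕ a + (toℕ k + (g ∸ toℕ a))) % g      ≡⟨ cong (_% g) (a+[x+[g∸a]]≡x+g (toℕ a) (toℕ k) (<⇒≤ (Finₚ.toℕ<n a))) ⟩
    (toℕ k + g) % g                          ≡⟨ [x+g]%g≡x k ⟩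
    toℕ k                                    ∎)
    where open ≡-Reasoning

  ⊕≡⇒≡⊖ : ∀ {a b k} → a ⊕ b ≡ k → b ≡ k ⊖ a
  ⊕≡⇒≡⊖ {a} {b} refl = Finₚ.toℕ-injective (sym (begin
    toℕ ((a ⊕ b) ⊖ a)                                ≡⟨ toℕ-⊖ (a ⊕ b) a ⟩
    (toℕ (a ⊕ b) + (g ∸ toℕ a)) % g                  ≡⟨ cong (λ r → (r + (g ∸ toℕ a)) % g) (toℕ-⊕ a b) ⟩
    ((toℕ a + toℕ b) % g + (g ∸ toℕ a)) % g          ≡⟨ cong (_% g) (+-comm ((toℕ a + toℕ b) % g) _) ⟩
    ((g ∸ toℕ a) + (toℕ a + toℕ b) % g) % g          ≡⟨ [m+n%g]%g≡[m+n]%g (g ∸ toℕ a) _ ⟩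
    ((g ∸ toℕ a) + (toℕ a + toℕ b)) % g              ≡⟨ cong (_% g) (+-comm (g ∸ toℕ a) _) ⟩
    (toℕ a + toℕ b + (g ∸ toℕ a)) % g                ≡⟨ cong (_% g) (+-assoc (toℕ a) (toℕ b) _) ⟩
    (toℕ a + (toℕ b + (g ∸ toℕ a))) % g              ≡⟨ cong (_% g) (a+[x+[g∸a]]≡x+g (toℕ a) (toℕ b) (<⇒≤ (Finₚ.toℕ<n a))) ⟩
    (toℕ b + g) % g                                  ≡⟨ [x+g]%g≡x b ⟩
    toℕ b                                            ∎))
    where open ≡-Reasoning

  ≡⊖⇒⊕≡ : ∀ {a b k} → a ≡ k ⊖ b → a ⊕ b ≡ k
  ≡⊖⇒⊕≡ {b = b} {k} refl = trans (⊕-comm (k ⊖ b) b) (⊕-⊖ b k)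

  ⊕-cancelˡ : ∀ a {b c} → a ⊕ b ≡ a ⊕ c → b ≡ c
  ⊕-cancelˡ a a⊕b≡a⊕c = trans (⊕≡⇒≡⊖ a⊕b≡a⊕c) (sym (⊕≡⇒≡⊖ refl))

  ⊖-cancelˡ : ∀ k {a b} → k ⊖ a ≡ k ⊖ b → a ≡ b
  ⊖-cancelˡ k {a} {b} k⊖a≡k⊖b = begin
    a                 ≡⟨ ⊕≡⇒≡⊖ (≡⊖⇒⊕≡ refl) ⟩
    k ⊖ (k ⊖ a)       ≡⟨ cong (k ⊖_) k⊖a≡k⊖b ⟩
    k ⊖ (k ⊖ b)       ≡⟨ ⊕≡⇒≡⊖ (≡⊖⇒⊕≡ refl) ⟨
    b                 ∎
    where open ≡-Reasoning

offset : ∀ {s} → Fin s → Fin s → ℕ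
offset {suc _} i a with i Finₚ.≟ a
... | yes _   = 0
... | no  i≢a = toℕ (punchOut i≢a)

offset< : ∀ {s} {i a : Fin s} → i ≢ a → offset i a < s ∸ 1
offset< {suc _} {i} {a} i≢a with i Finₚ.≟ a
... | yes i≡a = ⊥-elim (i≢a i≡a)
... | no  i≢a = Finₚ.toℕ<n (punchOut i≢a)

offset-injective : ∀ {s} {i a b : Fin s} → i ≢ a → i ≢ b → offset i a ≡ offset i b → a ≡ b
offset-injective {suc _} {i} {a} {b} i≢a i≢b same with i Finₚ.≟ a | i Finₚ.≟ b
... | yes i≡a | _       = ⊥-elim (i≢a i≡a)
... | _       | yes i≡b = ⊥-elim (i≢b i≡b)
... | no i≢a′ | no i≢b′ = Finₚ.punchOut-injective i≢a′ i≢b′ (Finₚ.toℕ-injective same)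

-- Without group lines, the points of one group must lie in pairwise distinct directions.
groupOffset : Bool → ∀ {s} → Fin s → Fin s → ℕ
groupOffset true  _ _ = 0
groupOffset false i a = offset i a

#groupOffsets : Bool → ℕ → ℕ
#groupOffsets true  _ = 1
#groupOffsets false s = s ∸ 1

groupOffset< : ∀ b {s t} {i a : Fin s} → s ≤ t → i ≢ a → groupOffset b i a < #groupOffsets b t
groupOffset< true  _   _   = s≤s z≤n
groupOffset< false s≤t i≢a = <-≤-trans (offset< i≢a) (∸-monoˡ-≤ 1 s≤t)

groupOffset-injective : ∀ b {s} {i a c : Fin s} → i ≢ a → i ≢ c →
                        groupOffset b i a ≡ groupOffset b i c → b ≡ true ⊎ a ≡ c
groupOffset-injective true  _   _   _    = inj₁ refl
groupOffset-injective false i≢a i≢c same = inj₂ (offset-injective i≢a i≢c same)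

-- The line system

module Construction {n m : ℕ} (g h : ℕ) .{{_ : NonZero g}} (h≤g : h ≤ g) (groupLines : Bool)
  (groupLines⇒g≤1+m : groupLines ≡ true → g ≤ suc m) (2≤m : 2 ≤ m)
  (#directions<n : g + #groupOffsets groupLines g < n) where

  open Modular g

  Point : Set
  Point = Fin g ⊎ Fin g ⊎ Fin h

  pattern px i = inj₁ i
  pattern py j = inj₂ (inj₁ j)
  pattern pz k = inj₂ (inj₂ k)

  ẑ : Fin h → Fin g
  ẑ k = inject≤ k h≤g

  ẑ-injective : ∀ {k c} → ẑ k ≡ ẑ c → k ≡ c
  ẑ-injective = Finₚ.inject≤-injective h≤g h≤g _ _

  toℕ-ẑ : ∀ {k c} → ẑ k ≡ c → toℕ k ≡ toℕ c
  toℕ-ẑ {k} refl = sym (Finₚ.toℕ-inject≤ k h≤g)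

  data Line : Set where
    triangle : Fin g → Fin g → Line
    xs ys zs : Line

  infix 4 _on_ _on?_

  data _on_ : Point → Line → Set where
    x-on-triangle : ∀ {i j}   → px i on triangle i j
    y-on-triangle : ∀ {i j}   → py j on triangle i j
    z-on-triangle : ∀ {i j k} → ẑ k ≡ i ⊕ j → pz k on triangle i j
    x-on-xs       : ∀ {i}     → groupLines ≡ true → px i on xs
    y-on-ys       : ∀ {j}     → groupLines ≡ true → py j on ys
    z-on-zs       : ∀ {k}     → groupLines ≡ true → pz k on zs

  _on?_ : ∀ u l → Dec (u on l)
  px a on? triangle i j = map′ (λ { refl → x-on-triangle }) (λ { x-on-triangle → refl }) (a Finₚ.≟ i)
  py b on? triangle i j = map′ (λ { refl → y-on-triangle }) (λ { y-on-triangle → refl }) (b Finₚ.≟ j)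
  pz k on? triangle i j = map′ z-on-triangle (λ { (z-on-triangle e) → e }) (ẑ k Finₚ.≟ i ⊕ j)
  px _ on? xs = map′ x-on-xs (λ { (x-on-xs t) → t }) (groupLines Bool.≟ true)
  py _ on? ys = map′ y-on-ys (λ { (y-on-ys t) → t }) (groupLines Bool.≟ true)
  pz _ on? zs = map′ z-on-zs (λ { (z-on-zs t) → t }) (groupLines Bool.≟ true)
  px _ on? ys = no λ ()
  px _ on? zs = no λ ()
  py _ on? xs = no λ ()
  py _ on? zs = no λ ()
  pz _ on? xs = no λ ()
  pz _ on? ys = no λ ()

  through : Point → Point → Line
  through (px _) (px _) = xs
  through (px i) (py j) = triangle i j
  through (px i) (pz k) = triangle i (ẑ k ⊖ i)
  through (py j) (px i) = triangle i j
  through (py _) (py _) = ys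
  through (py j) (pz k) = triangle (ẑ k ⊖ j) j
  through (pz k) (px i) = triangle i (ẑ k ⊖ i)
  through (pz k) (py j) = triangle (ẑ k ⊖ j) j
  through (pz _) (pz _) = zs

  on⇒≡through : ∀ {u v l} → u ≢ v → u on l → v on l → l ≡ through u v
  on⇒≡through u≢v x-on-triangle x-on-triangle = ⊥-elim (u≢v refl)
  on⇒≡through u≢v y-on-triangle y-on-triangle = ⊥-elim (u≢v refl)
  on⇒≡through u≢v (z-on-triangle e) (z-on-triangle e′) = ⊥-elim (u≢v (cong pz (ẑ-injective (trans e (sym e′)))))
  on⇒≡through _ x-on-triangle y-on-triangle = refl
  on⇒≡through _ y-on-triangle x-on-triangle = refl
  on⇒≡through _ (x-on-triangle {i}) (z-on-triangle e) = cong (triangle i) (⊕≡⇒≡⊖ (sym e))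
  on⇒≡through _ (z-on-triangle e) (x-on-triangle {i}) = cong (triangle i) (⊕≡⇒≡⊖ (sym e))
  on⇒≡through _ (y-on-triangle {i} {j}) (z-on-triangle e) = cong (λ i′ → triangle i′ j) (⊕≡⇒≡⊖ (sym (trans e (⊕-comm i j))))
  on⇒≡through _ (z-on-triangle e) (y-on-triangle {i} {j}) = cong (λ i′ → triangle i′ j) (⊕≡⇒≡⊖ (sym (trans e (⊕-comm i j))))
  on⇒≡through _ (x-on-xs _) (x-on-xs _) = refl
  on⇒≡through _ (y-on-ys _) (y-on-ys _) = refl
  on⇒≡through _ (z-on-zs _) (z-on-zs _) = refl

  #points : ℕ
  #points = g + (g + h)

  points : Fin #points ↔ Point
  points = ↔-trans Finₚ.+↔⊎ (↔-refl ⊎-↔ Finₚ.+↔⊎)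

  open Inverse points using () renaming (to to view; from to point; strictlyInverseʳ to point∘view)

  view-injective : ∀ {p q} → view p ≡ view q → p ≡ q
  view-injective {p} {q} e = trans (sym (point∘view p)) (trans (cong point e) (point∘view q))

  pointsOn : Line → Subset #points
  pointsOn l = tabulate λ p → does (view p on? l)

  ∈pointsOn⁺ : ∀ {p l} → view p on l → p ∈ pointsOn l
  ∈pointsOn⁺ {p} {l} on = lookup⇒[]= p _ (trans (lookup∘tabulate _ p) (dec-true (view p on? l) on))

  ∈pointsOn⁻ : ∀ {p l} → p ∈ pointsOn l → view p on l
  ∈pointsOn⁻ {p} {l} p∈ with view p on? l | trans (sym (lookup∘tabulate _ p)) ([]=⇒lookup p∈)
  ... | yes on | _ = on
  ... | no  _  | ()

  ∣pointsOn∣≤k : ∀ {k l} (f : Fin k → Point) → (∀ {u} → u on l → ∃ λ t → f t ≡ u) → ∣ pointsOn l ∣ ≤ k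
  ∣pointsOn∣≤k f covers = covered⇒∣p∣≤k (point ∘ f) λ {p} p∈ →
    let t , ft≡vp = covers (∈pointsOn⁻ p∈) in t , trans (cong point ft≡vp) (point∘view p)

  -- If i ⊕ j is not the index of a z-point, the triangle has only two points and its third corner repeats x_i.
  corner : Fin g → Fin g → Fin 3 → Point
  corner i _ zero             = px i
  corner _ j (suc zero)       = py j
  corner i j (suc (suc zero)) with toℕ (i ⊕ j) <? h
  ... | yes i⊕j<h = pz (fromℕ< i⊕j<h)
  ... | no  _     = px i

  z-corner : ∀ {i j k} → ẑ k ≡ i ⊕ j → corner i j (suc (suc zero)) ≡ pz k
  z-corner {i} {j} {k} ẑk≡i⊕j with toℕ (i ⊕ j) <? h
  ... | yes i⊕j<h = cong pz (Finₚ.toℕ-injective (trans (Finₚ.toℕ-fromℕ< i⊕j<h) (sym (toℕ-ẑ ẑk≡i⊕j))))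
  ... | no  i⊕j≮h = ⊥-elim (i⊕j≮h (subst (_< h) (toℕ-ẑ ẑk≡i⊕j) (Finₚ.toℕ<n k)))

  corner-covers : ∀ {i j u} → u on triangle i j → ∃ λ t → corner i j t ≡ u
  corner-covers x-on-triangle           = zero , refl
  corner-covers y-on-triangle           = suc zero , refl
  corner-covers (z-on-triangle ẑk≡i⊕j) = suc (suc zero) , z-corner ẑk≡i⊕j

  on-xs⁻ : ∀ {u} → u on xs → groupLines ≡ true × ∃ λ i → px i ≡ u
  on-xs⁻ (x-on-xs t) = t , _ , refl

  on-ys⁻ : ∀ {u} → u on ys → groupLines ≡ true × ∃ λ j → py j ≡ u
  on-ys⁻ (y-on-ys t) = t , _ , refl

  on-zs⁻ : ∀ {u} → u on zs → groupLines ≡ true × ∃ λ k → pz k ≡ u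
  on-zs⁻ (z-on-zs t) = t , _ , refl

  ∣pointsOn∣≤1+m : ∀ l → ∣ pointsOn l ∣ ≤ suc m
  ∣pointsOn∣≤1+m (triangle i j) = ≤-trans (∣pointsOn∣≤k (corner i j) corner-covers) (s≤s 2≤m)
  ∣pointsOn∣≤1+m xs = ∣p∣≤k-by-member λ p∈ →
    ≤-trans (∣pointsOn∣≤k px (proj₂ ∘ on-xs⁻)) (groupLines⇒g≤1+m (proj₁ (on-xs⁻ (∈pointsOn⁻ p∈))))
  ∣pointsOn∣≤1+m ys = ∣p∣≤k-by-member λ p∈ →
    ≤-trans (∣pointsOn∣≤k py (proj₂ ∘ on-ys⁻)) (groupLines⇒g≤1+m (proj₁ (on-ys⁻ (∈pointsOn⁻ p∈))))
  ∣pointsOn∣≤1+m zs = ∣p∣≤k-by-member λ p∈ →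
    ≤-trans (∣pointsOn∣≤k pz (proj₂ ∘ on-zs⁻)) (≤-trans h≤g (groupLines⇒g≤1+m (proj₁ (on-zs⁻ (∈pointsOn⁻ p∈)))))

  inGroup : ∀ {s} → Fin s → Fin s → ℕ
  inGroup i a = g + groupOffset groupLines i a

  direction : Point → Point → ℕ
  direction (px i) (px a) = inGroup i a
  direction (px i) (py b) = toℕ (i ⊕ b)
  direction (px _) (pz c) = toℕ (ẑ c)
  direction (py j) (px a) = toℕ (a ⊕ j)
  direction (py j) (py b) = inGroup j b
  direction (py _) (pz c) = toℕ (ẑ c)
  direction (pz _) (px a) = toℕ a
  direction (pz k) (py b) = toℕ (ẑ k ⊖ b)
  direction (pz k) (pz c) = inGroup k c

  #directions : ℕ
  #directions = g + #groupOffsets groupLines g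

  inGroup< : ∀ {s} {i a : Fin s} → s ≤ g → i ≢ a → inGroup i a < #directions
  inGroup< s≤g i≢a = +-monoʳ-< g (groupOffset< groupLines s≤g i≢a)

  cross< : (c : Fin g) → toℕ c < #directions
  cross< c = <-≤-trans (Finₚ.toℕ<n c) (m≤m+n g _)

  direction< : ∀ {u v} → u ≢ v → direction u v < #directions
  direction< {px _} {px _} u≢v = inGroup< ≤-refl (u≢v ∘ cong px)
  direction< {px i} {py b} _   = cross< (i ⊕ b)
  direction< {px _} {pz c} _   = cross< (ẑ c)
  direction< {py j} {px a} _   = cross< (a ⊕ j)
  direction< {py _} {py _} u≢v = inGroup< ≤-refl (u≢v ∘ cong py)
  direction< {py _} {pz c} _   = cross< (ẑ c)
  direction< {pz _} {px a} _   = cross< a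
  direction< {pz k} {py b} _   = cross< (ẑ k ⊖ b)
  direction< {pz _} {pz _} u≢v = inGroup< h≤g (u≢v ∘ cong pz)

  inGroup≢cross : ∀ {s} {i a : Fin s} (c : Fin g) → inGroup i a ≢ toℕ c
  inGroup≢cross c e = <⇒≱ (Finₚ.toℕ<n c) (subst (g ≤_) e (m≤m+n g _))

  sameInGroup⇒groupLines : ∀ {s} {i a b : Fin s} → i ≢ a → i ≢ b → a ≢ b → inGroup i a ≡ inGroup i b → groupLines ≡ true
  sameInGroup⇒groupLines i≢a i≢b a≢b e with groupOffset-injective groupLines i≢a i≢b (+-cancelˡ-≡ g _ _ e)
  ... | inj₁ t   = t
  ... | inj₂ a≡b = ⊥-elim (a≢b a≡b)

  CommonLine : Point → Point → Point → Set
  CommonLine u v w = ∃ λ l → u on l × v on l × w on l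

  sameDirection⇒commonLine : ∀ u v w → u ≢ v → u ≢ w → v ≢ w → direction u v ≡ direction u w → CommonLine u v w
  sameDirection⇒commonLine (px i) (px a) (px b) uv uw vw e =
    let t = sameInGroup⇒groupLines (uv ∘ cong px) (uw ∘ cong px) (vw ∘ cong px) e in xs , x-on-xs t , x-on-xs t , x-on-xs t
  sameDirection⇒commonLine (px i) (px a) (py b) _ _ _ e = ⊥-elim (inGroup≢cross (i ⊕ b) e)
  sameDirection⇒commonLine (px i) (px a) (pz c) _ _ _ e = ⊥-elim (inGroup≢cross (ẑ c) e)
  sameDirection⇒commonLine (px i) (py a) (px b) _ _ _ e = ⊥-elim (inGroup≢cross (i ⊕ a) (sym e))
  sameDirection⇒commonLine (px i) (py a) (py b) _ _ vw e = ⊥-elim (vw (cong py (⊕-cancelˡ i (Finₚ.toℕ-injective e))))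
  sameDirection⇒commonLine (px i) (py a) (pz c) _ _ _ e =
    triangle i a , x-on-triangle , y-on-triangle , z-on-triangle (sym (Finₚ.toℕ-injective e))
  sameDirection⇒commonLine (px i) (pz c) (px b) _ _ _ e = ⊥-elim (inGroup≢cross (ẑ c) (sym e))
  sameDirection⇒commonLine (px i) (pz c) (py b) _ _ _ e =
    triangle i b , x-on-triangle , z-on-triangle (Finₚ.toℕ-injective e) , y-on-triangle
  sameDirection⇒commonLine (px i) (pz c) (pz c′) _ _ vw e = ⊥-elim (vw (cong pz (ẑ-injective (Finₚ.toℕ-injective e))))
  sameDirection⇒commonLine (py j) (px a) (px b) _ _ vw e =
    ⊥-elim (vw (cong px (⊕-cancelˡ j (trans (⊕-comm j a) (trans (Finₚ.toℕ-injective e) (⊕-comm b j))))))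
  sameDirection⇒commonLine (py j) (px a) (py b) _ _ _ e = ⊥-elim (inGroup≢cross (a ⊕ j) (sym e))
  sameDirection⇒commonLine (py j) (px a) (pz c) _ _ _ e =
    triangle a j , y-on-triangle , x-on-triangle , z-on-triangle (sym (Finₚ.toℕ-injective e))
  sameDirection⇒commonLine (py j) (py a) (px b) _ _ _ e = ⊥-elim (inGroup≢cross (b ⊕ j) e)
  sameDirection⇒commonLine (py j) (py a) (py b) uv uw vw e =
    let t = sameInGroup⇒groupLines (uv ∘ cong py) (uw ∘ cong py) (vw ∘ cong py) e in ys , y-on-ys t , y-on-ys t , y-on-ys t
  sameDirection⇒commonLine (py j) (py a) (pz c) _ _ _ e = ⊥-elim (inGroup≢cross (ẑ c) e)
  sameDirection⇒commonLine (py j) (pz c) (px a) _ _ _ e =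
    triangle a j , y-on-triangle , z-on-triangle (Finₚ.toℕ-injective e) , x-on-triangle
  sameDirection⇒commonLine (py j) (pz c) (py b) _ _ _ e = ⊥-elim (inGroup≢cross (ẑ c) (sym e))
  sameDirection⇒commonLine (py j) (pz c) (pz c′) _ _ vw e = ⊥-elim (vw (cong pz (ẑ-injective (Finₚ.toℕ-injective e))))
  sameDirection⇒commonLine (pz k) (px a) (px b) _ _ vw e = ⊥-elim (vw (cong px (Finₚ.toℕ-injective e)))
  sameDirection⇒commonLine (pz k) (px a) (py b) _ _ _ e =
    triangle a b , z-on-triangle (sym (≡⊖⇒⊕≡ (Finₚ.toℕ-injective e))) , x-on-triangle , y-on-triangle
  sameDirection⇒commonLine (pz k) (px a) (pz c) _ _ _ e = ⊥-elim (inGroup≢cross a (sym e))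
  sameDirection⇒commonLine (pz k) (py a) (px b) _ _ _ e =
    triangle b a , z-on-triangle (sym (≡⊖⇒⊕≡ (Finₚ.toℕ-injective (sym e)))) , y-on-triangle , x-on-triangle
  sameDirection⇒commonLine (pz k) (py a) (py b) _ _ vw e = ⊥-elim (vw (cong py (⊖-cancelˡ (ẑ k) (Finₚ.toℕ-injective e))))
  sameDirection⇒commonLine (pz k) (py a) (pz c) _ _ _ e = ⊥-elim (inGroup≢cross (ẑ k ⊖ a) (sym e))
  sameDirection⇒commonLine (pz k) (pz c) (px b) _ _ _ e = ⊥-elim (inGroup≢cross b e)
  sameDirection⇒commonLine (pz k) (pz c) (py b) _ _ _ e = ⊥-elim (inGroup≢cross (ẑ k ⊖ b) e)
  sameDirection⇒commonLine (pz k) (pz c) (pz c′) uv uw vw e =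
    let t = sameInGroup⇒groupLines (uv ∘ cong pz) (uw ∘ cong pz) (vw ∘ cong pz) e in zs , z-on-zs t , z-on-zs t , z-on-zs t

  line : Fin #points → Fin #points → Subset #points
  line a b = pointsOn (through (view a) (view b))

  Collinear : Subset #points → Set
  Collinear X = ∃ λ a → ∃ λ b → X ⊆ line a b

  ⊆pointsOn⇒⊆line : ∀ {a b l X} → a ≢ b → view a on l → view b on l → X ⊆ pointsOn l → X ⊆ line a b
  ⊆pointsOn⇒⊆line {X = X} a≢b a-on b-on =
    subst (X ⊆_) (cong pointsOn (on⇒≡through (a≢b ∘ view-injective) a-on b-on))

  collinear⇒⊆line : ∀ {a b X} → a ≢ b → a ∈ X → b ∈ X → Collinear X → X ⊆ line a b
  collinear⇒⊆line a≢b a∈X b∈X (_ , _ , X⊆line) =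
    ⊆pointsOn⇒⊆line a≢b (∈pointsOn⁻ (X⊆line a∈X)) (∈pointsOn⁻ (X⊆line b∈X)) X⊆line

  sameDirection⇒collinear : ∀ {q y z} → q ≢ y → q ≢ z → y ≢ z →
    direction (view q) (view y) ≡ direction (view q) (view z) → Collinear (⁅ q ⁆ ∪ ⁅ y ⁆ ∪ ⁅ z ⁆)
  sameDirection⇒collinear {q} {y} {z} q≢y q≢z y≢z same
    with l , q-on , y-on , z-on ← sameDirection⇒commonLine (view q) (view y) (view z)
           (q≢y ∘ view-injective) (q≢z ∘ view-injective) (y≢z ∘ view-injective) same
    = q , y , ⊆pointsOn⇒⊆line q≢y q-on y-on qyz⊆l
    where
    qyz⊆l : ⁅ q ⁆ ∪ ⁅ y ⁆ ∪ ⁅ z ⁆ ⊆ pointsOn l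
    qyz⊆l p∈qyz with ∈⁅a⁆∪⁅b⁆∪⁅c⁆⁻ q y z p∈qyz
    ... | inj₁ refl        = ∈pointsOn⁺ q-on
    ... | inj₂ (inj₁ refl) = ∈pointsOn⁺ y-on
    ... | inj₂ (inj₂ refl) = ∈pointsOn⁺ z-on

  lineSystem : LineSystem #points n m
  lineSystem = record
    { Collinear               = Collinear
    ; collinear?              = λ X → Finₚ.any? λ a → Finₚ.any? λ b → X ⊆? line a b
    ; collinear-⊆             = λ { X⊆Y (a , b , Y⊆line) → a , b , λ x∈X → Y⊆line (X⊆Y x∈X) }
    ; line                    = line
    ; collinear⇒⊆line         = collinear⇒⊆line
    ; ∣line∣≤1+m              = λ a b → ∣pointsOn∣≤1+m (through (view a) (view b))
    ; #directions             = #directions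
    ; #directions<n           = #directions<n
    ; direction               = λ a b → direction (view a) (view b)
    ; direction<#directions   = λ q≢y → direction< (q≢y ∘ view-injective)
    ; sameDirection⇒collinear = sameDirection⇒collinear
    }

-- Choice of parameters

construction⇒ramseyColouring : ∀ {n m} g .{{_ : NonZero g}} groupLines → 3 ≤ n → 2 ≤ m →
  g + g ≤ n + m → n + m ≤ g + (g + g) → (groupLines ≡ true → g ≤ suc m) →
  g + #groupOffsets groupLines g < n → RamseyColouring (n + m) n m
construction⇒ramseyColouring {n} {m} g groupLines 3≤n 2≤m 2g≤n+m n+m≤3g groupLines⇒g≤1+m #directions<n =
  Colouring.ramseyColouring (subst (λ N → LineSystem N n m) g+[g+h]≡n+m lineSystem) 3≤n (≤-trans (s≤s z≤n) 2≤m)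
  where
  h : ℕ
  h = n + m ∸ (g + g)
  h≤g : h ≤ g
  h≤g = m≤n+o⇒m∸n≤o (n + m) (g + g) (subst (n + m ≤_) (sym (+-assoc g g g)) n+m≤3g)
  g+[g+h]≡n+m : g + (g + h) ≡ n + m
  g+[g+h]≡n+m = trans (sym (+-assoc g g h)) (m+[n∸m]≡n 2g≤n+m)
  open Construction {n} {m} g h h≤g groupLines groupLines⇒g≤1+m 2≤m #directions<n using (lineSystem)

ramseyColouring-n≥2m+2 : ∀ {n m} → 2 ≤ m → m + m + 2 ≤ n → RamseyColouring (n + m) n m
ramseyColouring-n≥2m+2 {n} {m} 2≤m 2m+2≤n =
  construction⇒ramseyColouring g false 3≤n 2≤m (≤-trans g+g≤n (m≤m+n n m)) n+m≤3g (λ ()) g+[g∸1]<n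
  where
  g : ℕ
  g = ⌊ n /2⌋
  1+m≤g : suc m ≤ g
  1+m≤g = subst (_≤ g) (trans (cong ⌊_/2⌋ (+-comm (m + m) 2)) (cong suc (sym (n≡⌊n+n/2⌋ m)))) (⌊n/2⌋-mono 2m+2≤n)
  instance
    g≢0 : NonZero g
    g≢0 = >-nonZero (≤-trans (s≤s z≤n) 1+m≤g)
  3≤n : 3 ≤ n
  3≤n = ≤-trans (+-monoˡ-≤ 2 (≤-trans (s≤s z≤n) (≤-trans 2≤m (m≤m+n m m)))) 2m+2≤n
  g+g≤n : g + g ≤ n
  g+g≤n = ≤-trans (+-monoʳ-≤ g (⌊n/2⌋≤⌈n/2⌉ n)) (≤-reflexive (⌊n/2⌋+⌈n/2⌉≡n n))
  open ≤-Reasoning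
  n+m≤3g : n + m ≤ g + (g + g)
  n+m≤3g = begin
    n + m              ≡⟨ cong (_+ m) (⌊n/2⌋+⌈n/2⌉≡n n) ⟨
    g + ⌈ n /2⌉ + m    ≤⟨ +-monoˡ-≤ m (+-monoʳ-≤ g (⌊n/2⌋-mono (n≤1+n (suc n)))) ⟩
    g + suc g + m      ≡⟨ trans (cong (_+ m) (+-suc g g)) (sym (+-suc (g + g) m)) ⟩
    g + g + suc m      ≤⟨ +-monoʳ-≤ (g + g) 1+m≤g ⟩
    g + g + g          ≡⟨ +-assoc g g g ⟩
    g + (g + g)        ∎
  g+[g∸1]<n : g + (g ∸ 1) < n
  g+[g∸1]<n = begin-strict
    g + (g ∸ 1)        <⟨ +-monoʳ-< g (∸-monoʳ-< (s≤s z≤n) (≤-trans (s≤s z≤n) 1+m≤g)) ⟩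
    g + (g ∸ 0)        ≤⟨ g+g≤n ⟩
    n                  ∎

ramseyColouring-m+3≤n≤2m+3 : ∀ {n m} → 2 ≤ m → m + 3 ≤ n → n ≤ m + m + 3 → RamseyColouring (n + m) n m
ramseyColouring-m+3≤n≤2m+3 {n} {m} 2≤m m+3≤n n≤2m+3 =
  construction⇒ramseyColouring (suc m) true (≤-trans (m≤n+m 3 m) m+3≤n) 2≤m 2g≤n+m n+m≤3g (λ _ → ≤-refl) g+1<n
  where
  open ≤-Reasoning
  2g≤n+m : suc m + suc m ≤ n + m
  2g≤n+m = begin
    suc m + suc m      ≡⟨ solve (m List.∷ List.[]) ⟩
    m + 2 + m          ≤⟨ +-monoˡ-≤ m (≤-trans (+-monoʳ-≤ m (n≤1+n 2)) m+3≤n) ⟩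
    n + m              ∎
  n+m≤3g : n + m ≤ suc m + (suc m + suc m)
  n+m≤3g = begin
    n + m                    ≤⟨ +-monoˡ-≤ m n≤2m+3 ⟩
    m + m + 3 + m            ≡⟨ solve (m List.∷ List.[]) ⟩
    suc m + (suc m + suc m)  ∎
  g+1<n : suc m + 1 < n
  g+1<n = begin-strict
    suc m + 1          <⟨ n<1+n _ ⟩
    suc (suc m + 1)    ≡⟨ solve (m List.∷ List.[]) ⟩
    m + 3              ≤⟨ m+3≤n ⟩
    n                  ∎

ramseyColouring-n≤m+2 : ∀ {n m} → 2 ≤ m → 3 ≤ n → n ≤ m + 2 → m + 6 ≤ n + n → RamseyColouring (n + m) n m
ramseyColouring-n≤m+2 {suc (suc n)} {m} 2≤m (s≤s (s≤s 1≤n)) 2+n≤m+2 m+6≤4+2n =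
  construction⇒ramseyColouring n {{>-nonZero 1≤n}} true (s≤s (s≤s 1≤n)) 2≤m 2g≤n+m n+m≤3g
    (λ _ → ≤-trans n≤m (n≤1+n m)) (s≤s (≤-reflexive (+-comm n 1)))
  where
  open ≤-Reasoning
  n≤m : n ≤ m
  n≤m = +-cancelʳ-≤ 2 n m (subst (_≤ m + 2) (+-comm 2 n) 2+n≤m+2)
  m+2≤2n : m + 2 ≤ n + n
  m+2≤2n = +-cancelʳ-≤ 4 (m + 2) (n + n) (begin
    m + 2 + 4                  ≡⟨ solve (m List.∷ List.[]) ⟩
    m + 6                      ≤⟨ m+6≤4+2n ⟩
    suc (suc n) + suc (suc n)  ≡⟨ solve (n List.∷ List.[]) ⟩
    n + n + 4                  ∎)
  2g≤n+m : n + n ≤ suc (suc n) + m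
  2g≤n+m = begin
    n + n              ≤⟨ +-monoʳ-≤ n n≤m ⟩
    n + m              ≤⟨ +-monoˡ-≤ m (≤-trans (n≤1+n n) (n≤1+n (suc n))) ⟩
    suc (suc n) + m    ∎
  n+m≤3g : suc (suc n) + m ≤ n + (n + n)
  n+m≤3g = begin
    suc (suc n) + m    ≡⟨ solve (n List.∷ m List.∷ List.[]) ⟩
    n + (m + 2)        ≤⟨ +-monoʳ-≤ n m+2≤2n ⟩
    n + (n + n)        ∎

ramseyColouring-2n≥m+6 : ∀ {n m} → 3 ≤ n → 2 ≤ m → m + 6 ≤ n + n → RamseyColouring (n + m) n m
ramseyColouring-2n≥m+6 {n} {m} 3≤n 2≤m m+6≤2n with m + m + 2 ≤? n | m + 3 ≤? n
... | yes 2m+2≤n | _         = ramseyColouring-n≥2m+2 2≤m 2m+2≤n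
... | no 2m+2≰n  | yes m+3≤n =
  ramseyColouring-m+3≤n≤2m+3 2≤m m+3≤n (≤-trans (n≤1+n n) (≤-trans (≰⇒> 2m+2≰n) (+-monoʳ-≤ (m + m) (n≤1+n 2))))
... | no _       | no m+3≰n  =
  ramseyColouring-n≤m+2 2≤m 3≤n (≤-pred (subst (suc n ≤_) (+-suc m 2) (≰⇒> m+3≰n))) m+6≤2n

ramseyColouring-6≤n : ∀ {n m} → 6 ≤ n → 2 ≤ m → RamseyColouring (n + m) n m
ramseyColouring-6≤n {n} {m} 6≤n 2≤m with m + 6 ≤? n + n
... | yes m+6≤2n = ramseyColouring-2n≥m+6 (≤-trans (from-yes (3 ≤? 6)) 6≤n) 2≤m m+6≤2n
... | no  m+6≰2n =
  swap-colours (subst (λ N → RamseyColouring N m n) (+-comm m n)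
    (ramseyColouring-2n≥m+6 3≤m (≤-trans (s≤s (s≤s z≤n)) 6≤n) n+6≤2m))
  where
  open ≤-Reasoning
  2n<m+6 : n + n < m + 6
  2n<m+6 = ≰⇒> m+6≰2n
  3≤m : 3 ≤ m
  3≤m = +-cancelʳ-≤ 6 3 m (begin
    3 + 6     ≤⟨ ≤-trans (+-mono-≤ (≤-trans (from-yes (3 ≤? 6)) 6≤n) 6≤n) (n≤1+n (n + n)) ⟩
    suc (n + n) ≤⟨ 2n<m+6 ⟩
    m + 6     ∎)
  n+6≤2m : n + 6 ≤ m + m
  n+6≤2m with k , refl ← m≤n⇒∃[o]m+o≡n 6≤n = +-cancelʳ-≤ 12 (6 + k + 6) (m + m) (begin
    6 + k + 6 + 12                              ≤⟨ m≤m+n _ (2 + 3 * k) ⟩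
    6 + k + 6 + 12 + (2 + 3 * k)                ≡⟨ solve (k List.∷ List.[]) ⟩
    suc (6 + k + (6 + k)) + suc (6 + k + (6 + k)) ≤⟨ +-mono-≤ 2n<m+6 2n<m+6 ⟩
    m + 6 + (m + 6)                             ≡⟨ solve (m List.∷ List.[]) ⟩
    m + m + 12                                  ∎)

-- Besides 2 ≤ m only 6 ≤ n is needed.
theorem4 : (n m : ℕ) → 1 ≤ n → 2 ≤ m → SizeCondition n m →
    Σ (Subset (n + m) → Bool) λ c →
      (¬ WeakSubposetOf m (n + m) (λ X → c X ≡ true)) ×
      (¬ WeakSubposetOf n (n + m) (λ X → c X ≡ false))
theorem4 n m _ 2≤m (18≤n , _) = ramseyColouring-6≤n (≤-trans (from-yes (6 ≤? 18)) 18≤n) 2≤m
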